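{- The class of $C^V_{12\times[6],12\times[8]}$-subgraph-free graphs of diameter at most $2$ has unbounded treedepth.
   Context: All graphs are finite, simple and undirected. $C^V_{12\times[6],12\times[8]}$ is the graph obtained by taking $24$ disjoint cycles, twelve of them on $6$ vertices and twelve on $8$ vertices, choosing one vertex on each cycle and identifying these $24$ chosen vertices into a single vertex. A graph is $F$-subgraph-free if it contains no subgraph isomorphic to $F$. The diameter of $G$ is the maximum distance between two vertices (infinite if disconnected). The treedepth of $G$ is the minimum height of a rooted forest $T$ with $V(T)=V(G)$ such that the endpoints of every edge of $G$ lie on a common root-to-leaf path of $T$; unbounded treedepth means no constant bounds the treedepth of all graphs in the class. -}

module Defs where

open import Data.Nat using (ℕ; zero; suc; _≤_; _<_; _∸_; _<?_)
open import Data.Empty using (⊥)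
open import Data.Fin using (Fin; toℕ)
open import Data.Bool using (Bool; true; false)
open import Data.Maybe using (Maybe; just; nothing)
open import Data.Product using (Σ; ∃; ∃-syntax; _×_; _,_)
open import Data.Sum using (_⊎_)
open import Relation.Nullary using (¬_; yes; no)
open import Relation.Binary.PropositionalEquality using (_≡_)

record Graph : Set where
  field
    n      : ℕ
    adj    : Fin n → Fin n → Bool
    sym    : ∀ u v → adj u v ≡ adj v u
    irrefl : ∀ v → adj v v ≡ false

open Graph public

-- The bouquet of cycles C^V_{...}: t cycles of lengths len i (each ≥ 3)
-- sharing a single vertex 'center'.  Cycle i consists of the center and
-- the (len i ∸ 1) petal vertices  petal i 0, …, petal i (len i ∸ 2),
-- with edges  center – petal i 0,  petal i k – petal i (k+1),
-- petal i (len i ∸ 2) – center.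

data BVertex (t : ℕ) (len : Fin t → ℕ) : Set where
  center : BVertex t len
  petal  : (i : Fin t) → Fin (len i ∸ 1) → BVertex t len

BAdj : (t : ℕ) (len : Fin t → ℕ) → BVertex t len → BVertex t len → Set
BAdj t len center    center      = ⊥
BAdj t len center    (petal i k) = (toℕ k ≡ 0) ⊎ (suc (toℕ k) ≡ len i ∸ 1)
BAdj t len (petal i k) center    = (toℕ k ≡ 0) ⊎ (suc (toℕ k) ≡ len i ∸ 1)
BAdj t len (petal i k) (petal j l) =
  Σ (i ≡ j) λ _ → (suc (toℕ k) ≡ toℕ l) ⊎ (suc (toℕ l) ≡ toℕ k)

ContainsBouquet : (t : ℕ) (len : Fin t → ℕ) → Graph → Set
ContainsBouquet t len G =
  Σ (BVertex t len → Fin (n G)) λ f →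
    (∀ x y → f x ≡ f y → x ≡ y) ×
    (∀ x y → BAdj t len x y → adj G (f x) (f y) ≡ true)

BouquetFree : (t : ℕ) (len : Fin t → ℕ) → Graph → Set
BouquetFree t len G = ¬ ContainsBouquet t len G

lenF : Fin 24 → ℕ
lenF i with toℕ i <? 12
... | yes _ = 6
... | no _ = 8

DiamLe2 : Graph → Set
DiamLe2 G = ∀ u v → (u ≡ v) ⊎ (adj G u v ≡ true) ⊎
                    (∃[ w ] (adj G u w ≡ true × adj G w v ≡ true))

-- Rooted forests on V(G), given by a parent function; 'level v' is the
-- number of vertices on the path from v to its root (roots have level 1),
-- which also witnesses acyclicity.

data Anc {m : ℕ} (par : Fin m → Maybe (Fin m)) : Fin m → Fin m → Set where
  here  : ∀ {u} → Anc par u u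
  there : ∀ {u w v} → par u ≡ just w → Anc par w v → Anc par u v

record EliminationForest (G : Graph) (k : ℕ) : Set where
  field
    parent      : Fin (n G) → Maybe (Fin (n G))
    level       : Fin (n G) → ℕ
    level-root  : ∀ v → parent v ≡ nothing → level v ≡ 1
    level-par   : ∀ v w → parent v ≡ just w → level v ≡ suc (level w)
    height≤     : ∀ v → level v ≤ k
    edges-on-path : ∀ u v → adj G u v ≡ true → Anc parent u v ⊎ Anc parent v u

TreedepthLe : Graph → ℕ → Set
TreedepthLe G k = EliminationForest G k

-- H N consists of six pairwise adjacent fixed vertices and a path 0 — 1 — ⋯ — N−1. The fixed
-- vertices are the edges of K₄ on four blocks, and path vertex a sees the three edges at block
-- ⌊a/2⌋ mod 4. Any two blocks share an edge, so H N has diameter 2; and a path on 2^k vertices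
-- has treedepth > k, since along it the levels of an elimination forest separate any two equal
-- values by a smaller one, and such a sequence of length 2^k climbs k levels.
-- A non-backtracking cycle of length ℓ through c whose other vertices all lie on the path runs
-- straight from some a to a + ℓ − 2, so c is an edge shared by blocks two (ℓ = 6) or three
-- (ℓ = 8) steps apart in cyclic order: a diagonal, resp. a side, of the 4-cycle of blocks.
-- Hence, wherever the centre of an embedded bouquet lies, its twelve 6-cycles or its twelve
-- 8-cycles each need a fixed vertex of their own, but there are only six.

module Submission where

open import Defs hiding (sym)
open import Data.Nat using (ℕ; zero; suc; _+_; _∸_; _^_; _≤_; _<_; _≤?_; _<?_; _≡ᵇ_; s≤s; z≤n; z<s)
open import Data.Nat.Properties
  using ( ≤-refl; ≤-trans; ≤-antisym; <-trans; <-irrefl; <-≤-trans; ≤-<-trans; <⇒≤; ≰⇒>; ≮⇒≥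
        ; n≤1+n; n<1+n; 1+n≰n; m≤n⇒m≤1+n; m≤n⇒m<n∨m≡n; m≤m+n; m≤n+m; m<n+m
        ; +-monoʳ-<; +-suc; +-identityʳ
        ; m≢1+n+m; m+n≮m; ∸-monoˡ-≤; m+n∸m≡n; m+[n∸m]≡n; m≤n+o⇒m∸n≤o; anyUpTo? )
open import Data.Nat.DivMod using (_mod_; m<n⇒m%n≡m)
open import Data.Fin using (Fin; toℕ; fromℕ<; _↑ˡ_; _↑ʳ_; _≟_)
open import Data.Fin.Patterns
open import Data.Fin.Properties
  using (toℕ-fromℕ<; toℕ-injective; toℕ-↑ˡ; toℕ-↑ʳ; toℕ<n; ↑ˡ-injective; ↑ʳ-injective; all?; any?; pigeonhole)
  renaming (<-irrefl to <ᶠ-irrefl)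
open import Data.Bool using (Bool; true; false; not)
open import Data.Bool.Properties using (not-¬) renaming (_≟_ to _≟ᵇ_)
open import Data.Maybe using (Maybe; just; nothing)
open import Data.Maybe.Properties using (just-injective)
open import Data.Product using (∃-syntax; _×_; _,_; proj₁)
open import Data.Sum using (_⊎_; inj₁; inj₂)
import Data.Sum as Sum
open import Data.Empty using (⊥; ⊥-elim)
open import Function using (_∘_; id)
open import Relation.Nullary using (¬_; Dec; yes; no; does; contradiction)
open import Relation.Nullary.Decidable using (toWitness; _→-dec_; _×-dec_; dec-true; dec-false)
open import Relation.Binary.PropositionalEquality
  using (_≡_; _≢_; refl; sym; trans; cong; subst; subst₂)

-- Vertex rankings along a path

IsRanking : (ℕ → ℕ) → ℕ → Set
IsRanking h N = ∀ {a b} → a < b → b < N → h a ≡ h b → ¬ (∀ {c} → a ≤ c → c ≤ b → h a ≤ h c)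

IsRanking-restrict : ∀ {h M N} → M ≤ N → IsRanking h N → IsRanking h M
IsRanking-restrict M≤N r a<b b<M = r a<b (<-≤-trans b<M M≤N)

IsRanking-shift : ∀ {h N} s → IsRanking h (s + N) → IsRanking (λ c → h (s + c)) N
IsRanking-shift {h} s r {a} {b} a<b b<N ha≡hb between =
  r (+-monoʳ-< s a<b) (+-monoʳ-< s b<N) ha≡hb between′
  where
  between′ : ∀ {c} → s + a ≤ c → c ≤ s + b → h (s + a) ≤ h c
  between′ {c} s+a≤c c≤s+b =
    subst (λ x → h (s + a) ≤ h x) (m+[n∸m]≡n (≤-trans (m≤m+n s a) s+a≤c))
      (between (subst (_≤ c ∸ s) (m+n∸m≡n s a) (∸-monoˡ-≤ s s+a≤c)) (m≤n+o⇒m∸n≤o c s c≤s+b))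

none-below⇒above : ∀ {h : ℕ → ℕ} {L P} → ¬ (∃[ c ] (c < P × h c ≤ L)) → ∀ {c} → c < P → suc L ≤ h c
none-below⇒above none c<P = ≰⇒> λ hc≤L → none (_ , c<P , hc≤L)

-- Split into halves: a half staying above L is a smaller instance one level up, and if both
-- halves dip to L the two dips form a forbidden valley.
ranking-height : ∀ d {h L} → IsRanking h (2 ^ d) → (∀ {c} → c < 2 ^ d → L ≤ h c) →
                 ∃[ c ] (c < 2 ^ d × L + d ≤ h c)
ranking-height zero {L = L} r low = 0 , s≤s z≤n , subst (_≤ _) (sym (+-identityʳ L)) (low (s≤s z≤n))
ranking-height (suc d) {h} {L} r low =
  split (anyUpTo? (λ c → h c ≤? L) P) (anyUpTo? (λ c → h (P + c) ≤? L) P)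
  where
  P = 2 ^ d
  P+b<2P : ∀ {b} → b < P → P + b < P + (P + 0)
  P+b<2P b<P = +-monoʳ-< P (<-≤-trans b<P (m≤m+n P 0))
  split : Dec (∃[ a ] (a < P × h a ≤ L)) → Dec (∃[ b ] (b < P × h (P + b) ≤ L)) →
          ∃[ c ] (c < 2 ^ suc d × L + suc d ≤ h c)
  split (no none) _ with ranking-height d (IsRanking-restrict (m≤m+n P _) r) (none-below⇒above {h} none)
  ... | c , c<P , hc = c , <-≤-trans c<P (m≤m+n P _) , subst (_≤ h c) (sym (+-suc L d)) hc
  split (yes _) (no none)
    with ranking-height d (IsRanking-restrict (m≤m+n P 0) (IsRanking-shift P r))
                          (none-below⇒above {λ c → h (P + c)} none)
  ... | c , c<P , hc = P + c , P+b<2P c<P , subst (_≤ h (P + c)) (sym (+-suc L d)) hc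
  split (yes (a , a<P , ha≤L)) (yes (b , b<P , hb≤L)) =
    ⊥-elim (r (<-≤-trans a<P (m≤m+n P b)) (P+b<2P b<P) (trans ha≡L (sym hb≡L)) between)
    where
    ha≡L = ≤-antisym ha≤L (low (<-≤-trans a<P (m≤m+n P _)))
    hb≡L = ≤-antisym hb≤L (low (P+b<2P b<P))
    between : ∀ {c} → a ≤ c → c ≤ P + b → h a ≤ h c
    between {c} _ c≤P+b = subst (_≤ h c) (sym ha≡L) (low (≤-<-trans c≤P+b (P+b<2P b<P)))

-- Elimination forests

module _ {m : ℕ} {par : Fin m → Maybe (Fin m)} where

  Anc-trans : ∀ {u v w} → Anc par u v → Anc par v w → Anc par u w
  Anc-trans here v↝w = v↝w
  Anc-trans (there e u′↝v) v↝w = there e (Anc-trans u′↝v v↝w)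

  Anc-comparable : ∀ {u a b} → Anc par u a → Anc par u b → Anc par a b ⊎ Anc par b a
  Anc-comparable here u↝b = inj₁ u↝b
  Anc-comparable u↝a@(there _ _) here = inj₂ u↝a
  Anc-comparable (there e w↝a) (there e′ w′↝b) with trans (sym e) e′
  ... | refl = Anc-comparable w↝a w′↝b

record Path (G : Graph) (N : ℕ) : Set where
  field
    vertex    : ℕ → Fin (n G)
    injective : ∀ {a b} → a < N → b < N → vertex a ≡ vertex b → a ≡ b
    adjacent  : ∀ {c} → suc c < N → adj G (vertex c) (vertex (suc c)) ≡ true

module _ {G : Graph} {k : ℕ} (F : EliminationForest G k) where
  open EliminationForest F

  Anc⇒level≤ : ∀ {u v} → Anc parent u v → level v ≤ level u
  Anc⇒level≤ here = ≤-refl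
  Anc⇒level≤ (there {u} {w} e w↝v) =
    ≤-trans (Anc⇒level≤ w↝v) (subst (level w ≤_) (sym (level-par u w e)) (n≤1+n (level w)))

  Anc∧level≡⇒≡ : ∀ {u v} → Anc parent u v → level u ≡ level v → u ≡ v
  Anc∧level≡⇒≡ here _ = refl
  Anc∧level≡⇒≡ (there {u} {w} e w↝v) lu≡lv =
    ⊥-elim (<-irrefl (sym lu≡lv)
      (≤-<-trans (Anc⇒level≤ w↝v) (subst (level w <_) (sym (level-par u w e)) ≤-refl)))

  level-positive : ∀ v → 1 ≤ level v
  level-positive v with parent v in e
  ... | nothing = subst (1 ≤_) (sym (level-root v e)) ≤-refl
  ... | just w  = subst (1 ≤_) (sym (level-par v w e)) (s≤s z≤n)

  -- Vertex a is an ancestor of every vertex between a and b: a first step out of its subtree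
  -- would land on an ancestor of vertex a of level ≥ that of a, i.e. on vertex a itself.
  levels-rank : ∀ {N} (P : Path G N) → IsRanking (λ c → level (Path.vertex P c)) N
  levels-rank {N} P {a} {b} a<b b<N la≡lb between =
    <-irrefl (sym (injective b<N (<-trans a<b b<N) vertex-b≡vertex-a)) a<b
    where
    open Path P

    step : ∀ {c} → a ≤ c → c < b →
           Anc parent (vertex c) (vertex a) → Anc parent (vertex (suc c)) (vertex a)
    step {c} a≤c c<b c↝a with edges-on-path _ _ (adjacent (≤-<-trans c<b b<N))
    ... | inj₂ c+1↝c = Anc-trans c+1↝c c↝a
    ... | inj₁ c↝c+1 with Anc-comparable c↝a c↝c+1
    ...   | inj₂ c+1↝a = c+1↝a
    ...   | inj₁ a↝c+1 = ⊥-elim (<-irrefl a≡c+1 (s≤s a≤c))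
      where
      a≡c+1 = injective (<-trans a<b b<N) (≤-<-trans c<b b<N)
                (Anc∧level≡⇒≡ a↝c+1 (≤-antisym (between (m≤n⇒m≤1+n a≤c) c<b) (Anc⇒level≤ a↝c+1)))

    descends-from-a : ∀ c → a ≤ c → c ≤ b → Anc parent (vertex c) (vertex a)
    descends-from-a zero z≤n _ = here
    descends-from-a (suc c) a≤c+1 c<b with m≤n⇒m<n∨m≡n a≤c+1
    ... | inj₂ refl = here
    ... | inj₁ (s≤s a≤c) = step a≤c c<b (descends-from-a c a≤c (<⇒≤ c<b))

    vertex-b≡vertex-a : vertex b ≡ vertex a
    vertex-b≡vertex-a = Anc∧level≡⇒≡ (descends-from-a b (<⇒≤ a<b) ≤-refl) (sym la≡lb)

path⇒¬treedepth≤ : ∀ {G k} → Path G (2 ^ k) → ¬ TreedepthLe G k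
path⇒¬treedepth≤ {k = k} P F
  with ranking-height k (levels-rank F P) (λ {c} _ → level-positive F (Path.vertex P c))
... | c , _ , k+1≤level = 1+n≰n (≤-trans k+1≤level (EliminationForest.height≤ F (Path.vertex P c)))

-- Non-backtracking walks and the cycles of a bouquet

record NonBacktracking {V : Set} (_~_ : V → V → Set) (ℓ : ℕ) (w : ℕ → V) : Set where
  field
    step      : ∀ {k} → k < ℓ → w k ~ w (suc k)
    no-u-turn : ∀ {k} → 2 + k ≤ ℓ → w k ≢ w (2 + k)

open NonBacktracking public

module _ {V : Set} {_~_ : V → V → Set} where

  NonBacktracking-restrict : ∀ {ℓ ℓ′ w} → ℓ ≤ ℓ′ → NonBacktracking _~_ ℓ′ w → NonBacktracking _~_ ℓ w
  NonBacktracking-restrict ℓ≤ℓ′ W = record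
    { step      = λ k<ℓ → step W (<-≤-trans k<ℓ ℓ≤ℓ′)
    ; no-u-turn = λ k+2≤ℓ → no-u-turn W (≤-trans k+2≤ℓ ℓ≤ℓ′)
    }

  NonBacktracking-tail : ∀ {ℓ w} → NonBacktracking _~_ (suc ℓ) w → NonBacktracking _~_ ℓ (w ∘ suc)
  NonBacktracking-tail W = record
    { step = λ k<ℓ → step W (s≤s k<ℓ) ; no-u-turn = λ k+2≤ℓ → no-u-turn W (s≤s k+2≤ℓ) }

  NonBacktracking-map : ∀ {U : Set} {_≈_ : U → U → Set} {ℓ w} (φ : V → U) →
    (∀ {x y} → φ x ≡ φ y → x ≡ y) → (∀ {x y} → x ~ y → φ x ≈ φ y) →
    NonBacktracking _~_ ℓ w → NonBacktracking _≈_ ℓ (φ ∘ w)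
  NonBacktracking-map φ φ-injective φ-adjacent W = record
    { step      = λ k<ℓ → φ-adjacent (step W k<ℓ)
    ; no-u-turn = λ k+2≤ℓ eq → no-u-turn W k+2≤ℓ (φ-injective eq)
    }

  NonBacktracking-pullback : ∀ {U : Set} {_≈_ : U → U → Set} {ℓ w} (φ : U → V) (p : ℕ → U) →
    (∀ {x y} → φ x ~ φ y → x ≈ y) → (∀ {k} → k ≤ ℓ → w k ≡ φ (p k)) →
    NonBacktracking _~_ ℓ w → NonBacktracking _≈_ ℓ p
  NonBacktracking-pullback φ p reflect w≡φp W = record
    { step      = λ {k} k<ℓ → reflect (subst₂ _~_ (w≡φp (<⇒≤ k<ℓ)) (w≡φp k<ℓ) (step W k<ℓ))
    ; no-u-turn = λ {k} k+2≤ℓ eq → no-u-turn W k+2≤ℓ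
        (trans (w≡φp (≤-trans (m≤n+m k 2) k+2≤ℓ)) (trans (cong φ eq) (sym (w≡φp k+2≤ℓ))))
    }

module _ {t : ℕ} {len : Fin t → ℕ} where

  -- rim i k is the k-th vertex around cycle i from the centre, and the centre again for k ≥ len i.
  rim : Fin t → ℕ → BVertex t len
  rim i zero = center
  rim i (suc k) with k <? len i ∸ 1
  ... | yes k<m = petal i (fromℕ< k<m)
  ... | no _    = center

  cycleOf : BVertex t len → Maybe (Fin t)
  cycleOf center      = nothing
  cycleOf (petal i _) = just i

  position : BVertex t len → ℕ
  position center      = 0
  position (petal _ k) = suc (toℕ k)

  private
    petal-bound : ∀ {i k} → suc k < len i → k < len i ∸ 1
    petal-bound = ∸-monoˡ-≤ 1

  rim-position : ∀ i {k} → k < len i → position (rim i k) ≡ k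
  rim-position i {zero} _ = refl
  rim-position i {suc k} k+1<len with k <? len i ∸ 1
  ... | yes k<m = cong suc (toℕ-fromℕ< k<m)
  ... | no k≮m  = contradiction (petal-bound k+1<len) k≮m

  rim-cycleOf : ∀ i {k} → suc k < len i → cycleOf (rim i (suc k)) ≡ just i
  rim-cycleOf i {k} k+1<len with k <? len i ∸ 1
  ... | yes _   = refl
  ... | no k≮m = contradiction (petal-bound k+1<len) k≮m

  rim-closed : ∀ i {m} → len i ≡ suc m → rim i (suc m) ≡ center
  rim-closed i {m} len≡m+1 with m <? len i ∸ 1
  ... | yes m<m = contradiction (subst (m <_) (cong (_∸ 1) len≡m+1) m<m) (<-irrefl refl)
  ... | no _    = refl

  rim-step : ∀ i {k} → 2 ≤ len i → k < len i → BAdj t len (rim i k) (rim i (suc k))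
  rim-step i {zero} 2≤len _ with 0 <? len i ∸ 1
  ... | yes 0<m = inj₁ (toℕ-fromℕ< 0<m)
  ... | no 0≮m  = contradiction (petal-bound 2≤len) 0≮m
  rim-step i {suc k} _ k+1<len with k <? len i ∸ 1 | suc k <? len i ∸ 1
  ... | no k≮m  | _        = contradiction (petal-bound k+1<len) k≮m
  ... | yes k<m | yes k+1<m = refl , inj₁ (trans (cong suc (toℕ-fromℕ< k<m)) (sym (toℕ-fromℕ< k+1<m)))
  ... | yes k<m | no k+1≮m  = inj₂ (trans (cong suc (toℕ-fromℕ< k<m)) (≤-antisym k<m (≮⇒≥ k+1≮m)))

  rim-no-u-turn : ∀ i {k} → 3 ≤ len i → 2 + k ≤ len i → rim i k ≢ rim i (2 + k)
  rim-no-u-turn i {k} 3≤len k+2≤len eq with m≤n⇒m<n∨m≡n k+2≤len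
  ... | inj₁ k+2<len = m≢1+n+m k (trans (sym (rim-position i (<-trans (m<n+m k z<s) k+2<len)))
                                        (trans (cong position eq) (rim-position i k+2<len)))
  ... | inj₂ k+2≡len =
    contradiction (subst (3 ≤_) (trans (sym k+2≡len) (cong (2 +_) k≡0)) 3≤len) λ { (s≤s (s≤s ())) }
    where
    k≡0 : k ≡ 0
    k≡0 = trans (sym (rim-position i (subst (k <_) k+2≡len (m<n+m k z<s))))
                (trans (cong position eq) (cong position (rim-closed i (sym k+2≡len))))

  rim-walk : ∀ i {ℓ} → len i ≡ ℓ → 3 ≤ ℓ → NonBacktracking (BAdj t len) ℓ (rim i)
  rim-walk i refl 3≤len = record
    { step = rim-step i (≤-trans (n≤1+n 2) 3≤len) ; no-u-turn = rim-no-u-turn i 3≤len }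

-- The graph H N

Block : Set
Block = Fin 4

next : Block → Block
next 0F = 1F
next 1F = 2F
next 2F = 3F
next 3F = 0F

-- The six fixed vertices are the edges 01, 02, 03, 12, 13, 23 of the complete graph on the
-- blocks; the diagonals 02 and 13 join blocks two steps apart in the cyclic order of next.
incident : Block → Fin 6 → Bool
incident 0F 0F = true
incident 0F 1F = true
incident 0F 2F = true
incident 1F 0F = true
incident 1F 3F = true
incident 1F 4F = true
incident 2F 1F = true
incident 2F 3F = true
incident 2F 5F = true
incident 3F 2F = true
incident 3F 4F = true
incident 3F 5F = true
incident _  _  = false

diagonal : Fin 6 → Bool
diagonal 1F = true
diagonal 4F = true
diagonal _  = false

blocks-meet : ∀ b c → ∃[ j ] (incident b j ≡ true × incident c j ≡ true)
blocks-meet = toWitness {a? = all? λ b → all? λ c → any? λ j →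
  (incident b j ≟ᵇ true) ×-dec (incident c j ≟ᵇ true)} _

opposite-blocks-meet-on-diagonal :
  ∀ b j → incident b j ≡ true → incident (next (next b)) j ≡ true → diagonal j ≡ true
opposite-blocks-meet-on-diagonal = toWitness {a? = all? λ b → all? λ j →
  (incident b j ≟ᵇ true) →-dec (incident (next (next b)) j ≟ᵇ true) →-dec (diagonal j ≟ᵇ true)} _

neighbouring-blocks-meet-off-diagonal :
  ∀ b j → incident b j ≡ true → incident (next (next (next b))) j ≡ true → diagonal j ≡ false
neighbouring-blocks-meet-off-diagonal = toWitness {a? = all? λ b → all? λ j →
  (incident b j ≟ᵇ true) →-dec (incident (next (next (next b))) j ≟ᵇ true) →-dec
  (diagonal j ≟ᵇ false)} _

block : ℕ → Block
block 0 = 0F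
block 1 = 0F
block (suc (suc a)) = next (block a)

consecutive : ℕ → ℕ → Bool
consecutive zero    b       = b ≡ᵇ 1
consecutive (suc a) zero    = a ≡ᵇ 0
consecutive (suc a) (suc b) = consecutive a b

consecutive-sym : ∀ a b → consecutive a b ≡ consecutive b a
consecutive-sym zero    zero    = refl
consecutive-sym zero    (suc b) = refl
consecutive-sym (suc a) zero    = refl
consecutive-sym (suc a) (suc b) = consecutive-sym a b

consecutive-irrefl : ∀ a → consecutive a a ≡ false
consecutive-irrefl zero    = refl
consecutive-irrefl (suc a) = consecutive-irrefl a

consecutive-suc : ∀ a → consecutive a (suc a) ≡ true
consecutive-suc zero    = refl
consecutive-suc (suc a) = consecutive-suc a

consecutive⇒ : ∀ a b → consecutive a b ≡ true → suc a ≡ b ⊎ suc b ≡ a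
consecutive⇒ zero       (suc zero) _   = inj₁ refl
consecutive⇒ (suc zero) zero       _   = inj₂ refl
consecutive⇒ (suc a)    (suc b)    a~b = Sum.map (cong suc) (cong suc) (consecutive⇒ a b a~b)

PathWalk : ℕ → (ℕ → ℕ) → Set
PathWalk = NonBacktracking (λ a b → consecutive a b ≡ true)

continue-up : ∀ {a b c} → suc a ≡ b → consecutive b c ≡ true → a ≢ c → suc b ≡ c
continue-up {a} {_} {c} refl b~c a≢c with consecutive⇒ (suc a) c b~c
... | inj₁ b+1≡c = b+1≡c
... | inj₂ refl  = contradiction refl a≢c

continue-down : ∀ {a b c} → suc b ≡ a → consecutive b c ≡ true → a ≢ c → suc c ≡ b
continue-down {_} {b} {c} refl b~c a≢c with consecutive⇒ b c b~c
... | inj₁ refl  = contradiction refl a≢c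
... | inj₂ c+1≡b = c+1≡b

-- The second components, the direction of the last step, are what carry the induction.
PathWalk-monotone : ∀ {m p} → PathWalk (suc m) p →
  (p (suc m) ≡ suc m + p 0 × suc (p m) ≡ p (suc m)) ⊎ (p 0 ≡ suc m + p (suc m) × suc (p (suc m)) ≡ p m)
PathWalk-monotone {zero} {p} W with consecutive⇒ (p 0) (p 1) (step W z<s)
... | inj₁ up   = inj₁ (sym up , up)
... | inj₂ down = inj₂ (sym down , down)
PathWalk-monotone {suc m} {p} W with PathWalk-monotone (NonBacktracking-restrict (n≤1+n _) W)
... | inj₁ (ascending , up) = inj₁ (trans (sym up′) (cong suc ascending) , up′)
  where up′ = continue-up up (step W ≤-refl) (no-u-turn W ≤-refl)
... | inj₂ (descending , down) =
  inj₂ (trans descending (trans (cong (suc m +_) (sym down′)) (+-suc (suc m) _)) , down′)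
  where down′ = continue-down down (step W ≤-refl) (no-u-turn W ≤-refl)

PathWalk-endpoints : ∀ {m p} → PathWalk (suc m) p → p (suc m) ≡ suc m + p 0 ⊎ p 0 ≡ suc m + p (suc m)
PathWalk-endpoints W = Sum.map proj₁ proj₁ (PathWalk-monotone W)

data Vertex : Set where
  fixed : Fin 6 → Vertex
  path  : ℕ → Vertex

adjacent : Vertex → Vertex → Bool
adjacent (fixed i) (fixed j) = not (does (i ≟ j))
adjacent (fixed j) (path a)  = incident (block a) j
adjacent (path a)  (fixed j) = incident (block a) j
adjacent (path a)  (path b)  = consecutive a b

_~_ : Vertex → Vertex → Set
u ~ v = adjacent u v ≡ true

adjacent-sym : ∀ u v → adjacent u v ≡ adjacent v u
adjacent-sym (fixed i) (fixed j) with i ≟ j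
... | yes refl = cong not (sym (dec-true (i ≟ i) refl))
... | no i≢j   = cong not (sym (dec-false (j ≟ i) (i≢j ∘ sym)))
adjacent-sym (fixed _) (path _)  = refl
adjacent-sym (path _)  (fixed _) = refl
adjacent-sym (path a)  (path b)  = consecutive-sym a b

adjacent-irrefl : ∀ v → adjacent v v ≡ false
adjacent-irrefl (fixed i) = cong not (dec-true (i ≟ i) refl)
adjacent-irrefl (path a)  = consecutive-irrefl a

Fixed : Vertex → Set
Fixed v = ∃[ j ] v ≡ fixed j

fixed? : ∀ v → Dec (Fixed v)
fixed? (fixed j) = yes (j , refl)
fixed? (path _)  = no λ ()

pathIndex : Vertex → ℕ
pathIndex (fixed _) = 0
pathIndex (path a)  = a

¬Fixed⇒path : ∀ {v} → ¬ Fixed v → v ≡ path (pathIndex v)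
¬Fixed⇒path {fixed j} ¬fixed = contradiction (j , refl) ¬fixed
¬Fixed⇒path {path _}  _      = refl

module _ {m : ℕ} {w : ℕ → Vertex} (W : NonBacktracking _~_ (3 + m) w) (closed : w (3 + m) ≡ w 0) where

  private
    none-interior : ¬ (∃[ k ] (k < 2 + m × Fixed (w (suc k)))) → ∀ {k} → k < 2 + m → ¬ Fixed (w (suc k))
    none-interior none k<2+m fixedₖ = none (_ , k<2+m , fixedₖ)

    nowhere-fixed : ¬ Fixed (w 0) → (∀ {k} → k < 2 + m → ¬ Fixed (w (suc k))) →
                    ∀ {k} → k ≤ 3 + m → ¬ Fixed (w k)
    nowhere-fixed ¬fixed₀ _        {zero}  _ = ¬fixed₀
    nowhere-fixed ¬fixed₀ interior {suc k} k<3+m with m≤n⇒m<n∨m≡n k<3+m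
    ... | inj₁ (s≤s k<2+m) = interior k<2+m
    ... | inj₂ refl        = ¬fixed₀ ∘ subst Fixed closed

  closed-path-walk-impossible : ¬ Fixed (w 0) → ¬ (∀ {k} → k < 2 + m → ¬ Fixed (w (suc k)))
  closed-path-walk-impossible ¬fixed₀ interior
    with PathWalk-endpoints (NonBacktracking-pullback path (pathIndex ∘ w) id
           (λ k≤3+m → ¬Fixed⇒path (nowhere-fixed ¬fixed₀ interior k≤3+m)) W)
  ... | inj₁ e = m≢1+n+m _ (trans (sym (cong pathIndex closed)) e)
  ... | inj₂ e = m≢1+n+m _ (trans e (cong (3 + m +_) (cong pathIndex closed)))

  fixed-base-incidences : ∀ {j} → w 0 ≡ fixed j → (∀ {k} → k < 2 + m → ¬ Fixed (w (suc k))) →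
    ∃[ a ] (incident (block a) j ≡ true × incident (block (suc m + a)) j ≡ true)
  fixed-base-incidences {j} w₀≡j interior = orient (PathWalk-endpoints interior-walk)
    where
    p : ℕ → ℕ
    p k = pathIndex (w (suc k))

    on-path : ∀ {k} → k < 2 + m → w (suc k) ≡ path (p k)
    on-path k<2+m = ¬Fixed⇒path (interior k<2+m)

    interior-walk : PathWalk (suc m) p
    interior-walk = NonBacktracking-pullback path p id (λ k≤1+m → on-path (s≤s k≤1+m))
                      (NonBacktracking-restrict (n≤1+n _) (NonBacktracking-tail W))

    first : incident (block (p 0)) j ≡ true
    first = subst₂ _~_ w₀≡j (on-path z<s) (step W z<s)

    last : incident (block (p (suc m))) j ≡ true
    last = subst₂ _~_ (on-path ≤-refl) (trans closed w₀≡j) (step W ≤-refl)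

    orient : p (suc m) ≡ suc m + p 0 ⊎ p 0 ≡ suc m + p (suc m) →
             ∃[ a ] (incident (block a) j ≡ true × incident (block (suc m + a)) j ≡ true)
    orient (inj₁ e) = p 0 , first , subst (λ x → incident (block x) j ≡ true) e last
    orient (inj₂ e) = p (suc m) , last , subst (λ x → incident (block x) j ≡ true) e first

  closed-walk-meets-fixed :
    (∃[ k ] (k < 2 + m × Fixed (w (suc k)))) ⊎
    (∃[ j ] (w 0 ≡ fixed j ×
             ∃[ a ] (incident (block a) j ≡ true × incident (block (suc m + a)) j ≡ true)))
  closed-walk-meets-fixed with anyUpTo? (λ k → fixed? (w (suc k))) (2 + m) | fixed? (w 0)
  ... | yes hit | _              = inj₁ hit
  ... | no none | yes (j , w₀≡j) = inj₂ (j , w₀≡j , fixed-base-incidences w₀≡j (none-interior none))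
  ... | no none | no ¬fixed₀     = ⊥-elim (closed-path-walk-impossible ¬fixed₀ (none-interior none))

isDiagonal : Vertex → Bool
isDiagonal (fixed j) = diagonal j
isDiagonal (path _)  = false

hexagon-meets-fixed : ∀ {w} → NonBacktracking _~_ 6 w → w 6 ≡ w 0 → isDiagonal (w 0) ≡ false →
                      ∃[ k ] (k < 5 × Fixed (w (suc k)))
hexagon-meets-fixed W closed off-diagonal with closed-walk-meets-fixed W closed
... | inj₁ hit                        = hit
... | inj₂ (j , w₀≡j , a , inc , inc′) =
  ⊥-elim (not-¬ (opposite-blocks-meet-on-diagonal (block a) j inc inc′)
                (subst (λ v → isDiagonal v ≡ false) w₀≡j off-diagonal))

octagon-meets-fixed : ∀ {w} → NonBacktracking _~_ 8 w → w 8 ≡ w 0 → isDiagonal (w 0) ≡ true →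
                      ∃[ k ] (k < 7 × Fixed (w (suc k)))
octagon-meets-fixed W closed on-diagonal with closed-walk-meets-fixed W closed
... | inj₁ hit                        = hit
... | inj₂ (j , w₀≡j , a , inc , inc′) =
  ⊥-elim (not-¬ (subst (λ v → isDiagonal v ≡ true) w₀≡j on-diagonal)
                (neighbouring-blocks-meet-off-diagonal (block a) j inc inc′))

decode : ℕ → Vertex
decode 0 = fixed 0F
decode 1 = fixed 1F
decode 2 = fixed 2F
decode 3 = fixed 3F
decode 4 = fixed 4F
decode 5 = fixed 5F
decode (suc (suc (suc (suc (suc (suc a)))))) = path a

encode : Vertex → ℕ
encode (fixed i) = toℕ i
encode (path a)  = 6 + a

encode-decode : ∀ m → encode (decode m) ≡ m
encode-decode 0 = refl
encode-decode 1 = refl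
encode-decode 2 = refl
encode-decode 3 = refl
encode-decode 4 = refl
encode-decode 5 = refl
encode-decode (suc (suc (suc (suc (suc (suc a)))))) = refl

decode-toℕ : ∀ (i : Fin 6) → decode (toℕ i) ≡ fixed i
decode-toℕ 0F = refl
decode-toℕ 1F = refl
decode-toℕ 2F = refl
decode-toℕ 3F = refl
decode-toℕ 4F = refl
decode-toℕ 5F = refl

vertexOf : ∀ {N} → Fin (6 + N) → Vertex
vertexOf u = decode (toℕ u)

vertexOf-injective : ∀ {N} {u v : Fin (6 + N)} → vertexOf u ≡ vertexOf v → u ≡ v
vertexOf-injective {u = u} {v} e =
  toℕ-injective (trans (sym (encode-decode (toℕ u))) (trans (cong encode e) (encode-decode (toℕ v))))

H : ℕ → Graph
H N = record
  { n      = 6 + N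
  ; adj    = λ u v → adjacent (vertexOf u) (vertexOf v)
  ; sym    = λ u v → adjacent-sym (vertexOf u) (vertexOf v)
  ; irrefl = λ v → adjacent-irrefl (vertexOf v)
  }

distinct-fixed-adjacent : ∀ {i j} → i ≢ j → fixed i ~ fixed j
distinct-fixed-adjacent {i} {j} i≢j = cong not (dec-false (i ≟ j) i≢j)

other-point : ∀ a j → incident (block a) j ≡ false → ∃[ i ] (i ≢ j × incident (block a) i ≡ true)
other-point a j j∉a with blocks-meet (block a) (block a)
... | i , i∈a , _ = i , (λ { refl → contradiction (trans (sym i∈a) j∉a) λ () }) , i∈a

diameter-two : ∀ u v → u ≡ v ⊎ u ~ v ⊎ ∃[ j ] (u ~ fixed j × fixed j ~ v)
diameter-two (fixed i) (fixed j) with i ≟ j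
... | yes refl = inj₁ refl
... | no _     = inj₂ (inj₁ refl)
diameter-two (fixed j) (path a) with incident (block a) j in j∈a
... | true  = inj₂ (inj₁ refl)
... | false with other-point a j j∈a
...   | i , i≢j , i∈a = inj₂ (inj₂ (i , distinct-fixed-adjacent (i≢j ∘ sym) , i∈a))
diameter-two (path a) (fixed j) with incident (block a) j in j∈a
... | true  = inj₂ (inj₁ refl)
... | false with other-point a j j∈a
...   | i , i≢j , i∈a = inj₂ (inj₂ (i , i∈a , distinct-fixed-adjacent i≢j))
diameter-two (path a) (path b) with blocks-meet (block a) (block b)
... | j , j∈a , j∈b = inj₂ (inj₂ (j , j∈a , j∈b))

vertexOf-↑ˡ : ∀ {N} (j : Fin 6) → vertexOf (j ↑ˡ N) ≡ fixed j
vertexOf-↑ˡ {N} j = trans (cong decode (toℕ-↑ˡ j N)) (decode-toℕ j)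

H-diameter≤2 : ∀ N → DiamLe2 (H N)
H-diameter≤2 N u v with diameter-two (vertexOf u) (vertexOf v)
... | inj₁ u≡v         = inj₁ (vertexOf-injective u≡v)
... | inj₂ (inj₁ u~v)  = inj₂ (inj₁ u~v)
... | inj₂ (inj₂ (j , u~j , j~v)) = inj₂ (inj₂ (j ↑ˡ N ,
  subst (vertexOf u ~_) (sym (vertexOf-↑ˡ j)) u~j , subst (_~ vertexOf v) (sym (vertexOf-↑ˡ j)) j~v))

spine : ∀ N → Path (H N) N
spine N = record
  { vertex    = spineVertex
  ; injective = λ a<N b<N e →
      trans (sym (index a<N)) (trans (cong (pathIndex ∘ vertexOf) e) (index b<N))
  ; adjacent  = λ {c} c+1<N →
      subst₂ _~_ (sym (on-path (<-trans (n<1+n c) c+1<N))) (sym (on-path c+1<N)) (consecutive-suc c)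
  }
  where
  -- mod only makes the map total; for c < N it is the vertex numbered 6 + c.
  spineVertex : ℕ → Fin (6 + N)
  spineVertex c = (6 + c) mod (6 + N)

  on-path : ∀ {c} → c < N → vertexOf (spineVertex c) ≡ path c
  on-path {c} c<N = cong decode (trans (toℕ-fromℕ< _) (m<n⇒m%n≡m (+-monoʳ-< 6 c<N)))

  index : ∀ {c} → c < N → pathIndex (vertexOf (spineVertex c)) ≡ c
  index c<N = cong pathIndex (on-path c<N)

lenF-↑ˡ : ∀ (i : Fin 12) → lenF (i ↑ˡ 12) ≡ 6
lenF-↑ˡ i with toℕ (i ↑ˡ 12) <? 12
... | yes _   = refl
... | no i≮12 = contradiction (subst (_< 12) (sym (toℕ-↑ˡ i 12)) (toℕ<n i)) i≮12

lenF-↑ʳ : ∀ (i : Fin 12) → lenF (12 ↑ʳ i) ≡ 8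
lenF-↑ʳ i with toℕ (12 ↑ʳ i) <? 12
... | yes i<12 = contradiction (subst (_< 12) (toℕ-↑ʳ 12 i) i<12) (m+n≮m 12 (toℕ i))
... | no _     = refl

module _ {N : ℕ} (f : BVertex 24 lenF → Fin (6 + N)) (f-injective : ∀ x y → f x ≡ f y → x ≡ y)
         (f-adjacent : ∀ x y → BAdj 24 lenF x y → vertexOf (f x) ~ vertexOf (f y)) where

  φ : BVertex 24 lenF → Vertex
  φ x = vertexOf (f x)

  φ-injective : ∀ {x y} → φ x ≡ φ y → x ≡ y
  φ-injective e = f-injective _ _ (vertexOf-injective e)

  cycle-walk : ∀ i {ℓ} → lenF i ≡ ℓ → 3 ≤ ℓ → NonBacktracking _~_ ℓ (φ ∘ rim i)
  cycle-walk i len≡ℓ 3≤ℓ = NonBacktracking-map φ φ-injective (f-adjacent _ _) (rim-walk i len≡ℓ 3≤ℓ)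

  FixedOnCycle : Fin 24 → Set
  FixedOnCycle i = ∃[ k ] (suc k < lenF i × Fixed (φ (rim i (suc k))))

  point : ∀ {i} → FixedOnCycle i → Fin 6
  point (_ , _ , j , _) = j

  same-point⇒same-cycle : ∀ {i i′} (h : FixedOnCycle i) (h′ : FixedOnCycle i′) →
                          point h ≡ point h′ → i ≡ i′
  same-point⇒same-cycle {i} {i′} (_ , k<len , _ , at-j) (_ , k′<len , _ , at-j′) refl =
    just-injective (trans (sym (rim-cycleOf i k<len))
      (trans (cong cycleOf (φ-injective (trans at-j (sym at-j′)))) (rim-cycleOf i′ k′<len)))

  twelve-cycles-cannot-all-meet-fixed : (e : Fin 12 → Fin 24) → (∀ c d → e c ≡ e d → c ≡ d) →
                ((c : Fin 12) → FixedOnCycle (e c)) → ⊥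
  twelve-cycles-cannot-all-meet-fixed e e-injective hits with pigeonhole (m<n+m 6 {6} z<s) (point ∘ hits)
  ... | c , d , c<d , same =
    <ᶠ-irrefl (e-injective c d (same-point⇒same-cycle (hits c) (hits d) same)) c<d

  hexagons-meet-fixed : isDiagonal (φ center) ≡ false → (c : Fin 12) → FixedOnCycle (c ↑ˡ 12)
  hexagons-meet-fixed off-diagonal c =
    let k , k<5 , fixedₖ =
          hexagon-meets-fixed (cycle-walk i len≡6 (m≤n+m 3 3)) (cong φ (rim-closed i len≡6)) off-diagonal
    in  k , subst (suc k <_) (sym len≡6) (s≤s k<5) , fixedₖ
    where
    i = c ↑ˡ 12
    len≡6 = lenF-↑ˡ c

  octagons-meet-fixed : isDiagonal (φ center) ≡ true → (c : Fin 12) → FixedOnCycle (12 ↑ʳ c)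
  octagons-meet-fixed on-diagonal c =
    let k , k<7 , fixedₖ =
          octagon-meets-fixed (cycle-walk i len≡8 (m≤n+m 3 5)) (cong φ (rim-closed i len≡8)) on-diagonal
    in  k , subst (suc k <_) (sym len≡8) (s≤s k<7) , fixedₖ
    where
    i = 12 ↑ʳ c
    len≡8 = lenF-↑ʳ c

  no-bouquet : ⊥
  no-bouquet with isDiagonal (φ center) in centre
  ... | false = twelve-cycles-cannot-all-meet-fixed (_↑ˡ 12) (↑ˡ-injective 12) (hexagons-meet-fixed centre)
  ... | true  = twelve-cycles-cannot-all-meet-fixed (12 ↑ʳ_) (↑ʳ-injective 12) (octagons-meet-fixed centre)

H-bouquet-free : ∀ N → BouquetFree 24 lenF (H N)
H-bouquet-free N (f , f-injective , f-adjacent) = no-bouquet f f-injective f-adjacent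

theorem19 : ∀ (k : ℕ) → ∃[ G ] (BouquetFree 24 lenF G × DiamLe2 G × ¬ TreedepthLe G k)
theorem19 k =
  H (2 ^ k) , H-bouquet-free (2 ^ k) , H-diameter≤2 (2 ^ k) , path⇒¬treedepth≤ (spine (2 ^ k))
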